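{- Let $w$ be a word of length $n\ge 1$ over an alphabet $\Sigma$ such that $SP_{n-1}(w)=2$. Then $w$ is not a palindrome.
   Context: A scattered subword of $w$ is a (not necessarily contiguous) subsequence of $w$. A palindrome is a word equal to its reversal. For $t\ge 0$, $SP_t(w)$ is the number of distinct palindromes of length $t$ that are scattered subwords of $w$. -}

module Defs where

open import Data.Nat using (ℕ)
open import Data.List using (List; length; reverse)
open import Data.List.Relation.Binary.Sublist.Propositional using (_⊆_)
open import Data.List.Relation.Unary.Unique.Propositional using (Unique)
open import Data.List.Membership.Propositional using (_∈_)
open import Data.Product using (Σ; _×_)
open import Function.Bundles using (_⇔_)
open import Relation.Binary.PropositionalEquality using (_≡_)

ScatteredSubword : {A : Set} → List A → List A → Set
ScatteredSubword u w = u ⊆ w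

Palindrome : {A : Set} → List A → Set
Palindrome u = reverse u ≡ u

IsSP : {A : Set} → ℕ → List A → List A → Set
IsSP t w u = (length u ≡ t) × Palindrome u × ScatteredSubword u w

-- "SP_t(w) = k": the set of distinct palindromes of length t that are
-- scattered subwords of w has exactly k elements, i.e. it is enumerated
-- by a duplicate-free list of length k.
SPcount : {A : Set} → ℕ → List A → ℕ → Set
SPcount t w k =
  Σ (List _) λ xs → (length xs ≡ k) × Unique xs × (∀ u → (u ∈ xs) ⇔ IsSP t w u)

{-# OPTIONS --safe #-}
-- A palindrome w of length at least 2 is a·m·a with m a palindrome. A palindromic
-- subword of length |w| - 1 either keeps both outer letters, and is then a·u·a with u
-- a palindromic subword of length |m| - 1 of m, or drops one of them, and is then m·a
-- or a·m; that is a palindrome only if a·m = m·a, i.e. w is a power of the letter a,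
-- whose subwords of a given length all coincide. By induction a palindrome has at most
-- one palindromic subword of length |w| - 1, so SP_{|w|-1}(w) = 2 forces w not to be one.
module Submission where

open import Defs
open import Data.Nat using (ℕ; zero; suc; _∸_; _≥_)
open import Data.Nat.Properties using (suc-injective; 1+n≢0)
open import Data.List using (List; []; _∷_; length; reverse; replicate; _∷ʳ_; initLast; _∷ʳ′_)
open import Data.List.Properties using (reverse-++; unfold-reverse; ∷-injective; ∷ʳ-injectiveˡ)
open import Data.List.Relation.Binary.Sublist.Propositional using (_⊆_; []; _∷_) renaming (_∷ʳ_ to _skip_)
open import Data.List.Relation.Binary.Sublist.Propositional.Properties using (to-≋)
open import Data.List.Relation.Binary.Pointwise using (Pointwise-≡⇒≡)
open import Data.List.Relation.Unary.AllPairs using (_∷_)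
open import Data.List.Relation.Unary.All using ([]; _∷_)
open import Data.List.Relation.Unary.Any using (here; there)
open import Data.List.Membership.Propositional using (_∈_)
open import Data.Product using (Σ-syntax; _×_; _,_; proj₂)
open import Data.Sum using (_⊎_; inj₁; inj₂)
open import Data.Empty using (⊥-elim)
open import Function.Bundles using (Equivalence)
open import Relation.Binary.PropositionalEquality using (_≡_; refl; sym; trans; cong; subst; module ≡-Reasoning)
open import Relation.Nullary using (¬_)

module _ {A : Set} where

  length-∷ʳ : (xs : List A) (x : A) → length (xs ∷ʳ x) ≡ suc (length xs)
  length-∷ʳ [] x = refl
  length-∷ʳ (_ ∷ xs) x = cong suc (length-∷ʳ xs x)

  replicate-∷ʳ : (n : ℕ) (a : A) → replicate n a ∷ʳ a ≡ replicate (suc n) a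
  replicate-∷ʳ zero a = refl
  replicate-∷ʳ (suc n) a = cong (a ∷_) (replicate-∷ʳ n a)

  ∷≡∷ʳ⇒replicate : (a : A) (xs : List A) → a ∷ xs ≡ xs ∷ʳ a → xs ≡ replicate (length xs) a
  ∷≡∷ʳ⇒replicate a [] _ = refl
  ∷≡∷ʳ⇒replicate a (x ∷ xs) eq with ∷-injective eq
  ... | refl , eq′ = cong (a ∷_) (∷≡∷ʳ⇒replicate a xs eq′)

  length≡0⇒≡[] : {xs : List A} → length xs ≡ 0 → xs ≡ []
  length≡0⇒≡[] {[]} _ = refl

  ⊆-length-≡⇒≡ : {xs ys : List A} → xs ⊆ ys → length xs ≡ length ys → xs ≡ ys
  ⊆-length-≡⇒≡ p eq = Pointwise-≡⇒≡ (to-≋ eq p)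

  ⊆-replicate : (n : ℕ) (a : A) {xs : List A} → xs ⊆ replicate n a → xs ≡ replicate (length xs) a
  ⊆-replicate zero a [] = refl
  ⊆-replicate (suc n) a (_ skip p) = ⊆-replicate n a p
  ⊆-replicate (suc n) a (refl ∷ p) = cong (a ∷_) (⊆-replicate n a p)

  ⊆-replicate-unique : (n : ℕ) (a : A) {u v : List A} → u ⊆ replicate n a → v ⊆ replicate n a →
    length u ≡ length v → u ≡ v
  ⊆-replicate-unique n a {u} {v} u⊆ v⊆ len = begin
    u                        ≡⟨ ⊆-replicate n a u⊆ ⟩
    replicate (length u) a   ≡⟨ cong (λ k → replicate k a) len ⟩
    replicate (length v) a   ≡⟨ ⊆-replicate n a v⊆ ⟨
    v                        ∎
    where open ≡-Reasoning

  ⊆-∷ʳ⁻ : (xs : List A) (a : A) {ys : List A} → ys ⊆ xs ∷ʳ a →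
    ys ⊆ xs ⊎ Σ[ zs ∈ List A ] ys ≡ zs ∷ʳ a × zs ⊆ xs
  ⊆-∷ʳ⁻ [] a (_ skip []) = inj₁ []
  ⊆-∷ʳ⁻ [] a (refl ∷ []) = inj₂ ([] , refl , [])
  ⊆-∷ʳ⁻ (x ∷ xs) a (_ skip p) with ⊆-∷ʳ⁻ xs a p
  ... | inj₁ q = inj₁ (x skip q)
  ... | inj₂ (zs , eq , q) = inj₂ (zs , eq , x skip q)
  ⊆-∷ʳ⁻ (x ∷ xs) a (refl ∷ p) with ⊆-∷ʳ⁻ xs a p
  ... | inj₁ q = inj₁ (refl ∷ q)
  ... | inj₂ (zs , eq , q) = inj₂ (x ∷ zs , cong (x ∷_) eq , refl ∷ q)

  ⊆-∷-∷ʳ⁻ : (a b : A) (xs : List A) {ys : List A} → ys ⊆ a ∷ xs ∷ʳ b →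
    length ys ≡ suc (length xs) →
    ys ≡ xs ∷ʳ b ⊎ ys ≡ a ∷ xs ⊎ Σ[ zs ∈ List A ] ys ≡ a ∷ zs ∷ʳ b × zs ⊆ xs
  ⊆-∷-∷ʳ⁻ a b xs (_ skip p) eq =
    inj₁ (⊆-length-≡⇒≡ p (trans eq (sym (length-∷ʳ xs b))))
  ⊆-∷-∷ʳ⁻ a b xs (refl ∷ p) eq with ⊆-∷ʳ⁻ xs b p
  ... | inj₁ q = inj₂ (inj₁ (cong (a ∷_) (⊆-length-≡⇒≡ q (suc-injective eq))))
  ... | inj₂ (zs , refl , q) = inj₂ (inj₂ (zs , refl , q))

  reverse-∷-∷ʳ : (a b : A) (xs : List A) → reverse (a ∷ xs ∷ʳ b) ≡ b ∷ reverse xs ∷ʳ a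
  reverse-∷-∷ʳ a b xs = begin
    reverse (a ∷ xs ∷ʳ b)   ≡⟨ unfold-reverse a (xs ∷ʳ b) ⟩
    reverse (xs ∷ʳ b) ∷ʳ a  ≡⟨ cong (_∷ʳ a) (reverse-++ xs (b ∷ [])) ⟩
    b ∷ reverse xs ∷ʳ a     ∎
    where open ≡-Reasoning

  palindrome-∷-∷ʳ⁻ : (a b : A) (xs : List A) → Palindrome (a ∷ xs ∷ʳ b) →
    b ≡ a × Palindrome xs
  palindrome-∷-∷ʳ⁻ a b xs pal with ∷-injective (trans (sym (reverse-∷-∷ʳ a b xs)) pal)
  ... | refl , eq = refl , ∷ʳ-injectiveˡ (reverse xs) xs eq

  palindrome-view : (k : ℕ) (w : List A) → length w ≡ suc (suc k) → Palindrome w →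
    Σ[ a ∈ A ] Σ[ m ∈ List A ] w ≡ a ∷ m ∷ʳ a × length m ≡ k × Palindrome m
  palindrome-view k (a ∷ t) len pal with initLast t
  ... | m ∷ʳ′ b with palindrome-∷-∷ʳ⁻ a b m pal
  ... | refl , pal-m =
    a , m , refl , suc-injective (trans (sym (length-∷ʳ m a)) (suc-injective len)) , pal-m

  PalindromicDeletion : List A → List A → Set
  PalindromicDeletion w u = Palindrome u × u ⊆ w × suc (length u) ≡ length w

  palindromicDeletion-of-∷-∷ʳ : (a : A) (m : List A) {u : List A} → Palindrome m →
    PalindromicDeletion (a ∷ m ∷ʳ a) u →
    m ≡ replicate (length m) a ⊎ Σ[ u′ ∈ List A ] u ≡ a ∷ u′ ∷ʳ a × PalindromicDeletion m u′
  palindromicDeletion-of-∷-∷ʳ a m pal-m (pal-u , u⊆w , len)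
    with ⊆-∷-∷ʳ⁻ a a m u⊆w (suc-injective (trans len (cong suc (length-∷ʳ m a))))
  ... | inj₁ refl = inj₁ (∷≡∷ʳ⇒replicate a m (begin
    a ∷ m             ≡⟨ cong (a ∷_) pal-m ⟨
    a ∷ reverse m     ≡⟨ reverse-++ m (a ∷ []) ⟨
    reverse (m ∷ʳ a)  ≡⟨ pal-u ⟩
    m ∷ʳ a            ∎))
    where open ≡-Reasoning
  ... | inj₂ (inj₁ refl) = inj₁ (∷≡∷ʳ⇒replicate a m (begin
    a ∷ m             ≡⟨ pal-u ⟨
    reverse (a ∷ m)   ≡⟨ unfold-reverse a m ⟩
    reverse m ∷ʳ a    ≡⟨ cong (_∷ʳ a) pal-m ⟩
    m ∷ʳ a            ∎))
    where open ≡-Reasoning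
  ... | inj₂ (inj₂ (u′ , refl , u′⊆m)) =
    inj₂ (u′ , refl , proj₂ (palindrome-∷-∷ʳ⁻ a a u′ pal-u) , u′⊆m ,
          suc-injective (begin
            suc (suc (length u′))  ≡⟨ cong suc (length-∷ʳ u′ a) ⟨
            suc (length (u′ ∷ʳ a)) ≡⟨ suc-injective len ⟩
            length (m ∷ʳ a)        ≡⟨ length-∷ʳ m a ⟩
            suc (length m)         ∎))
    where open ≡-Reasoning

  palindromicDeletion-of-constant : (a : A) (m : List A) {u v : List A} →
    m ≡ replicate (length m) a →
    PalindromicDeletion (a ∷ m ∷ʳ a) u → PalindromicDeletion (a ∷ m ∷ʳ a) v → u ≡ v
  palindromicDeletion-of-constant a m {u} {v} m-const (_ , u⊆w , len-u) (_ , v⊆w , len-v) =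
    ⊆-replicate-unique _ a (subst (u ⊆_) w-const u⊆w) (subst (v ⊆_) w-const v⊆w)
      (suc-injective (trans len-u (sym len-v)))
    where
    w-const : a ∷ m ∷ʳ a ≡ replicate (suc (suc (length m))) a
    w-const = cong (a ∷_) (trans (cong (_∷ʳ a) m-const) (replicate-∷ʳ (length m) a))

  palindromicDeletion-unique : (n : ℕ) {w u v : List A} → length w ≡ n → Palindrome w →
    PalindromicDeletion w u → PalindromicDeletion w v → u ≡ v
  palindromicDeletion-unique zero len _ (_ , _ , len-u) _ = ⊥-elim (1+n≢0 (trans len-u len))
  palindromicDeletion-unique (suc zero) len _ (_ , _ , len-u) (_ , _ , len-v) =
    trans (length≡0⇒≡[] (suc-injective (trans len-u len)))
          (sym (length≡0⇒≡[] (suc-injective (trans len-v len))))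
  palindromicDeletion-unique (suc (suc k)) {w} len pal-w du dv
    with palindrome-view k w len pal-w
  ... | a , m , refl , len-m , pal-m
    with palindromicDeletion-of-∷-∷ʳ a m pal-m du | palindromicDeletion-of-∷-∷ʳ a m pal-m dv
  ... | inj₁ m-const | _ = palindromicDeletion-of-constant a m m-const du dv
  ... | inj₂ _ | inj₁ m-const = palindromicDeletion-of-constant a m m-const du dv
  ... | inj₂ (u′ , refl , du′) | inj₂ (v′ , refl , dv′) =
    cong (λ x → a ∷ x ∷ʳ a) (palindromicDeletion-unique k len-m pal-m du′ dv′)

  isSP-pred⇒palindromicDeletion : {w : List A} (x : A) {u : List A} →
    IsSP (length w) (x ∷ w) u → PalindromicDeletion (x ∷ w) u
  isSP-pred⇒palindromicDeletion x (len , pal , u⊆w) = pal , u⊆w , cong suc len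

lemma4p11 : {A : Set} (w : List A) → length w ≥ 1 →
    SPcount (length w ∸ 1) w 2 → ¬ Palindrome w
lemma4p11 (x ∷ w) _ (u ∷ v ∷ [] , _ , (u≢v ∷ []) ∷ _ , enum) pal-w =
  u≢v (palindromicDeletion-unique _ refl pal-w (deletion (here refl)) (deletion (there (here refl))))
  where
  deletion : ∀ {t} → t ∈ u ∷ v ∷ [] → PalindromicDeletion (x ∷ w) t
  deletion {t} t∈ = isSP-pred⇒palindromicDeletion x (Equivalence.to (enum t) t∈)
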